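{- Let $G$ be a filter in the Ignatiev algebra $\mathfrak{I}$ and let $n\in\omega$. Let $H=\Diamond_n^\mathfrak{I}G$ be the $\le_\mathfrak{I}$-upward closed subset of $I$ generated by $\{\Diamond_n^\mathfrak{I}\vec\gamma:\vec\gamma\in G\}$; this is a filter. Let $\vec\alpha=\vec\alpha_G$ and $\vec\nu=\vec\alpha_H$. Then $\vec\nu=\sigma_n(\vec\alpha)$.
   Context: Ordinal conventions: $\varepsilon_0$ is the least ordinal $\varepsilon$ with $\omega^\varepsilon=\varepsilon$. For an ordinal $\alpha>0$, $\ell(\alpha)$ is the unique $\beta$ such that $\alpha=\gamma+\omega^\beta$ for some $\gamma$. Also $\ell(0)=0$. $\mathrm{Lim}$ denotes the class of limit ordinals. Ignatiev sequences: $I$ is the set of sequences $\vec\alpha=(\alpha_i)_{i\in\omega}$ of ordinals $<\varepsilon_0$ with $\alpha_{i+1}\le\ell(\alpha_i)$ for all $i$. Ignatiev algebra $\mathfrak{I}$: its universe is $I$. The order is $\vec\alpha\le_\mathfrak{I}\vec\beta$ iff $\alpha_i\ge\beta_i$ for all $i$. The meet $\vec\alpha\land_\mathfrak{I}\vec\beta$ is the $\le_\mathfrak{I}$-greatest lower bound. Explicitly, put $\gamma_i=\max(\alpha_i,\beta_i)$ and take $N$ with $\gamma_i=0$ for $i\ge N$. Then $\vec\delta=\vec\alpha\land_\mathfrak{I}\vec\beta$ has $\delta_i=0$ for $i\ge N$, and downward for $i<N$: $\delta_i=\gamma_i$ if $\ell(\gamma_i)\ge\delta_{i+1}$, and $\delta_i=\gamma_i+\omega^{\delta_{i+1}}$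 otherwise. The operator $\Diamond_n^\mathfrak{I}$: $\Diamond_n^\mathfrak{I}\vec\alpha=\vec\beta$ where $\beta_i=0$ for $i>n$, and recursively for $i=n,\dots,0$, $\beta_i=\alpha_i+\omega^{\beta_{i+1}}$. Filters: a filter in $\mathfrak{I}$ is a nonempty $F\subseteq I$ that is upward closed under $\le_\mathfrak{I}$ and closed under $\land_\mathfrak{I}$. For a filter $F$, $\vec\alpha_F$ is the sequence with $i$-th term $\sup\{\beta_i+1:\vec\beta\in F\}$. The sequence $\sigma_n(\vec\alpha)$: for a sequence $\vec\alpha$ of nonzero ordinals, $\sigma_n(\vec\alpha):=(\alpha'_0,\dots,\alpha'_n,1,1,\dots)$. Here $\alpha'_{n+1}=1$, and recursively for $i=n,n-1,\dots,0$: - $\alpha'_i=\alpha_i$ if $\ell(\alpha_i)\ge\alpha'_{i+1}$; - otherwise $\alpha'_i=\alpha_i+\omega^{\alpha'_{i+1}}$ if $\alpha'_{i+1}\in\mathrm{Lim}$; - otherwise $\alpha'_i=\alpha_i+\omega^\delta+1$ if $\alpha'_{i+1}=\delta+1$ and $\ell(\alpha_i)<\delta$; - otherwise $\alpha'_i=\alpha_i+1$ if $\alpha'_{i+1}=\delta+1$ and $\ell(\alpha_i)=\delta$. -}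

module Defs where

open import Data.Nat using (ℕ; zero; suc; _∸_; _≤?_)
open import Data.Maybe using (Maybe; just; nothing)
open import Data.Product using (Σ; _×_; ∃)
open import Data.Sum using (_⊎_)
open import Data.Empty using (⊥)
open import Data.Unit using (⊤)
open import Relation.Nullary using (¬_; yes; no)
open import Relation.Binary.PropositionalEquality using (_≡_)

-- Ordinals below ε₀ in Cantor normal form.
-- ω^ a + b  denotes  ω^a + b.

infixr 6 ω^_+_
data Cnf : Set where
  𝟎     : Cnf
  ω^_+_ : Cnf → Cnf → Cnf

data Cmp : Set where
  lt eq gt : Cmp

cmp : Cnf → Cnf → Cmp
cmp 𝟎 𝟎 = eq
cmp 𝟎 (ω^ _ + _) = lt
cmp (ω^ _ + _) 𝟎 = gt
cmp (ω^ a + b) (ω^ c + d) with cmp a c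
... | lt = lt
... | gt = gt
... | eq = cmp b d

_<ᶜ_ : Cnf → Cnf → Set
a <ᶜ b = cmp a b ≡ lt

_≤ᶜ_ : Cnf → Cnf → Set
a ≤ᶜ b = (cmp a b ≡ lt) ⊎ (cmp a b ≡ eq)

data LeadLe : Cnf → Cnf → Set where
  lead𝟎 : ∀ {a} → LeadLe 𝟎 a
  leadω : ∀ {a c d} → c ≤ᶜ a → LeadLe (ω^ c + d) a

data NF : Cnf → Set where
  nf𝟎 : NF 𝟎
  nfω : ∀ {a b} → NF a → NF b → LeadLe b a → NF (ω^ a + b)

one : Cnf
one = ω^ 𝟎 + 𝟎

infixl 5 _⊕_
_⊕_ : Cnf → Cnf → Cnf
𝟎 ⊕ b = b
(ω^ a + a') ⊕ 𝟎 = ω^ a + a'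
(ω^ a + a') ⊕ (ω^ c + d) with cmp a c
... | lt = ω^ c + d
... | eq = ω^ a + (a' ⊕ (ω^ c + d))
... | gt = ω^ a + (a' ⊕ (ω^ c + d))

ωp : Cnf → Cnf
ωp a = ω^ a + 𝟎

ℓ : Cnf → Cnf
ℓ 𝟎 = 𝟎
ℓ (ω^ a + 𝟎) = a
ℓ (ω^ a + (ω^ c + d)) = ℓ (ω^ c + d)

-- Ordinals ≤ ε₀ (needed since sup{β_i+1} may equal ε₀)

data Ord⁺ : Set where
  fin : Cnf → Ord⁺
  ε₀  : Ord⁺

data NF⁺ : Ord⁺ → Set where
  nfFin : ∀ {a} → NF a → NF⁺ (fin a)
  nfε₀  : NF⁺ ε₀

data _≤⁺_ : Ord⁺ → Ord⁺ → Set where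
  fin≤fin : ∀ {a b} → a ≤ᶜ b → fin a ≤⁺ fin b
  fin≤ε₀  : ∀ {a} → fin a ≤⁺ ε₀
  ε₀≤ε₀   : ε₀ ≤⁺ ε₀

ℓ⁺ : Ord⁺ → Ord⁺
ℓ⁺ (fin a) = fin (ℓ a)
ℓ⁺ ε₀ = ε₀          -- ε₀ = ω^ε₀

le⁺? : Ord⁺ → Ord⁺ → Cmp
le⁺? (fin a) (fin b) = cmp a b
le⁺? (fin a) ε₀ = lt
le⁺? ε₀ (fin b) = gt
le⁺? ε₀ ε₀ = eq

-- x + ω^y for x, y ≤ ε₀.  The case x = ε₀ is never used below
-- (there ℓ(x) = ε₀ ≥ y, so σ_n takes its first clause).
_⊕ω^_ : Ord⁺ → Ord⁺ → Ord⁺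
fin a ⊕ω^ fin b = fin (a ⊕ ωp b)
fin a ⊕ω^ ε₀ = ε₀
ε₀ ⊕ω^ _ = ε₀

-- if a = δ + 1 then just δ, otherwise nothing (a = 0 or a limit)
succView : Cnf → Maybe Cnf
succView 𝟎 = nothing
succView (ω^ 𝟎 + 𝟎) = just 𝟎
succView (ω^ (ω^ _ + _) + 𝟎) = nothing
succView (ω^ a + (ω^ c + d)) with succView (ω^ c + d)
... | just δ = just (ω^ a + δ)
... | nothing = nothing

Seq : Set
Seq = ℕ → Cnf

record I : Set where
  field
    seq : Seq
    nf  : ∀ i → NF (seq i)
    ign : ∀ i → seq (suc i) ≤ᶜ ℓ (seq i)
open I public

_≤ᴵ_ : Seq → Seq → Set
α ≤ᴵ β = ∀ i → β i ≤ᶜ α i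

IsMeet : I → I → I → Set
IsMeet α β δ = (seq δ ≤ᴵ seq α) × (seq δ ≤ᴵ seq β)
             × (∀ (w : I) → seq w ≤ᴵ seq α → seq w ≤ᴵ seq β → seq w ≤ᴵ seq δ)

record IsFilter (F : I → Set) : Set where
  field
    nonempty : Σ I F
    upward   : ∀ (α β : I) → seq α ≤ᴵ seq β → F α → F β
    meet     : ∀ (α β δ : I) → F α → F β → IsMeet α β δ → F δ

-- ◇_n on sequences: β_i = 0 for i > n, β_i = α_i + ω^{β_{i+1}} for i ≤ n
diamAux : Seq → ℕ → ℕ → Cnf
diamAux α zero i = α i ⊕ ωp 𝟎
diamAux α (suc k) i = α i ⊕ ωp (diamAux α k (suc i))

◇ : ℕ → Seq → Seq
◇ n α i with i ≤? n
... | yes _ = diamAux α (n ∸ i) i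
... | no _ = 𝟎

◇Up : ℕ → (I → Set) → I → Set
◇Up n G β = Σ I (λ γ → G γ × (◇ n (seq γ) ≤ᴵ seq β))

IsSupSucc : (I → Set) → ℕ → Ord⁺ → Set
IsSupSucc F i o =
  NF⁺ o
  × (∀ (β : I) → F β → fin (seq β i ⊕ one) ≤⁺ o)
  × (∀ (o' : Ord⁺) → NF⁺ o' → (∀ (β : I) → F β → fin (seq β i ⊕ one) ≤⁺ o') → o ≤⁺ o')

IsAlphaF : (I → Set) → (ℕ → Ord⁺) → Set
IsAlphaF F x = ∀ i → IsSupSucc F i (x i)

-- one step: given α_i = x and α'_{i+1} = y, compute α'_i
σstep : Ord⁺ → Ord⁺ → Ord⁺
σstep x y with le⁺? y (ℓ⁺ x)
... | lt = x
... | eq = x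
σstep x ε₀ | gt = x ⊕ω^ ε₀
σstep x (fin c) | gt with succView c
... | nothing = x ⊕ω^ fin c
... | just δ with le⁺? (ℓ⁺ x) (fin δ)
...   | lt = (x ⊕ω^ fin δ) ⊕ω^ fin 𝟎
...   | eq = x ⊕ω^ fin 𝟎
...   | gt = x ⊕ω^ fin 𝟎                          -- impossible (ℓ(α_i) < δ+1)

σAux : (ℕ → Ord⁺) → ℕ → ℕ → Ord⁺
σAux α zero i = σstep (α i) (fin one)
σAux α (suc k) i = σstep (α i) (σAux α k (suc i))

σ : ℕ → (ℕ → Ord⁺) → ℕ → Ord⁺
σ n α i with i ≤? n
... | yes _ = σAux α (n ∸ i) i
... | no _ = fin one

module Submission where

open import Defs
open import Data.Nat using (ℕ; zero; suc; pred; z≤n; s≤s; _∸_; _+_; _⊔_; _≤?_)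
  renaming (_≤_ to _≤ℕ_; _<_ to _<ℕ_)
import Data.Nat.Properties as ℕ
open import Data.Maybe using (just; nothing; map)
open import Data.Product using (Σ; _×_; _,_; proj₁; proj₂)
open import Data.Sum using (_⊎_; inj₁; inj₂)
open import Data.Empty using (⊥)
open import Relation.Nullary using (¬_; Dec; yes; no; contradiction)
open import Relation.Binary.PropositionalEquality
  using (_≡_; _≢_; refl; sym; trans; cong; cong₂; subst; subst₂; resp₂; isEquivalence; module ≡-Reasoning)
import Relation.Binary.Construct.StrictToNonStrict as StrictToNonStrict

-- Idea. (◇ₙγ)ᵢ = γᵢ + ω^((◇ₙγ)ᵢ₊₁) for i ≤ n and 0 for i > n, and every member
-- of H lies above some ◇ₙγ with γ ∈ G, so νᵢ = sup{(◇ₙγ)ᵢ + 1 : γ ∈ G}. Above n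
-- this is 1. For i ≤ n the family γ ↦ (γᵢ, (◇ₙγ)ᵢ₊₁) is directed, because a
-- filter contains the meet of any two members. The core computation
-- (SupOfSums.sup-of-sums) shows that over a directed family
--   sup{x + ω^y + 1} = σstep(sup{x + 1}, sup{y + 1}),
-- by cases along the clauses of σₙ: y absorbed by ℓ(x), y a limit, y a
-- successor. Hence ν obeys the same downward recursion as σₙ(α) and equals it.

infix 4 _≺_
data _≺_ : Cnf → Cnf → Set where
  𝟎≺ω  : ∀ {a b} → 𝟎 ≺ ω^ a + b
  head≺ : ∀ {a b c d} → a ≺ c → ω^ a + b ≺ ω^ c + d
  tail≺ : ∀ {a b d} → b ≺ d → ω^ a + b ≺ ω^ a + d

≺-irrefl : ∀ {a} → ¬ (a ≺ a)
≺-irrefl (head≺ p) = ≺-irrefl p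
≺-irrefl (tail≺ p) = ≺-irrefl p

≺-trans : ∀ {a b c} → a ≺ b → b ≺ c → a ≺ c
≺-trans 𝟎≺ω       (head≺ q) = 𝟎≺ω
≺-trans 𝟎≺ω       (tail≺ q) = 𝟎≺ω
≺-trans (head≺ p) (head≺ q) = head≺ (≺-trans p q)
≺-trans (head≺ p) (tail≺ q) = head≺ p
≺-trans (tail≺ p) (head≺ q) = head≺ q
≺-trans (tail≺ p) (tail≺ q) = tail≺ (≺-trans p q)

≺-asym : ∀ {a b} → a ≺ b → ¬ (b ≺ a)
≺-asym p q = ≺-irrefl (≺-trans p q)

infix 4 _≼_
_≼_ : Cnf → Cnf → Set
_≼_ = StrictToNonStrict._≤_ _≡_ _≺_

≼-refl : ∀ {a} → a ≼ a
≼-refl = inj₂ refl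

≼-trans : ∀ {a b c} → a ≼ b → b ≼ c → a ≼ c
≼-trans = StrictToNonStrict.trans _≡_ _≺_ isEquivalence (resp₂ _≺_) ≺-trans

≼-antisym : ∀ {a b} → a ≼ b → b ≼ a → a ≡ b
≼-antisym = StrictToNonStrict.antisym _≡_ _≺_ isEquivalence ≺-trans (λ { refl → ≺-irrefl })

≺-≼-trans : ∀ {a b c} → a ≺ b → b ≼ c → a ≺ c
≺-≼-trans = StrictToNonStrict.<-≤-trans _≡_ _≺_ ≺-trans (proj₁ (resp₂ _≺_))

≼-≺-trans : ∀ {a b c} → a ≼ b → b ≺ c → a ≺ c
≼-≺-trans = StrictToNonStrict.≤-<-trans _≡_ _≺_ sym ≺-trans (proj₂ (resp₂ _≺_))

≼⇒≯ : ∀ {a b} → a ≼ b → ¬ (b ≺ a)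
≼⇒≯ a≼b b≺a = ≺-irrefl (≺-≼-trans b≺a a≼b)

≼∧≢⇒≺ : ∀ {a b} → a ≼ b → a ≢ b → a ≺ b
≼∧≢⇒≺ (inj₁ p) _  = p
≼∧≢⇒≺ (inj₂ e) ne = contradiction e ne

𝟎≼ : ∀ {a} → 𝟎 ≼ a
𝟎≼ {𝟎}        = ≼-refl
𝟎≼ {ω^ a + b} = inj₁ 𝟎≺ω

head≼ : ∀ {a b c d} → ω^ a + b ≺ ω^ c + d → a ≼ c
head≼ (head≺ p) = inj₁ p
head≼ (tail≺ _) = ≼-refl

cmp-refl : ∀ a → cmp a a ≡ eq
cmp-refl 𝟎 = refl
cmp-refl (ω^ a + b) rewrite cmp-refl a = cmp-refl b

cmp≡lt : ∀ {a b} → cmp a b ≡ lt → a ≺ b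
cmp≡gt : ∀ {a b} → cmp a b ≡ gt → b ≺ a
cmp≡eq : ∀ {a b} → cmp a b ≡ eq → a ≡ b

cmp≡lt {𝟎} {ω^ c + d} _ = 𝟎≺ω
cmp≡lt {ω^ a + b} {ω^ c + d} p with cmp a c in e
... | lt = head≺ (cmp≡lt e)
... | eq with refl ← cmp≡eq {a} {c} e = tail≺ (cmp≡lt p)
cmp≡gt {ω^ a + b} {𝟎} _ = 𝟎≺ω
cmp≡gt {ω^ a + b} {ω^ c + d} p with cmp a c in e
... | gt = head≺ (cmp≡gt e)
... | eq with refl ← cmp≡eq {a} {c} e = tail≺ (cmp≡gt p)
cmp≡eq {𝟎} {𝟎} _ = refl
cmp≡eq {ω^ a + b} {ω^ c + d} p with cmp a c in e
... | eq = cong₂ ω^_+_ (cmp≡eq e) (cmp≡eq p)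

≺⇒cmp≡lt : ∀ {a b} → a ≺ b → cmp a b ≡ lt
≺⇒cmp≡lt {a} {b} p with cmp a b in e
... | lt = refl
... | eq = contradiction (cmp≡eq {a} {b} e) (λ { refl → ≺-irrefl p })
... | gt = contradiction (cmp≡gt e) (≺-asym p)

≺⇒cmp≡gt : ∀ {a b} → b ≺ a → cmp a b ≡ gt
≺⇒cmp≡gt {a} {b} p with cmp a b in e
... | gt = refl
... | eq = contradiction (cmp≡eq {a} {b} e) (λ { refl → ≺-irrefl p })
... | lt = contradiction (cmp≡lt e) (≺-asym p)

≤ᶜ⇒≼ : ∀ {a b} → a ≤ᶜ b → a ≼ b
≤ᶜ⇒≼ (inj₁ p) = inj₁ (cmp≡lt p)
≤ᶜ⇒≼ (inj₂ p) = inj₂ (cmp≡eq p)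

≼⇒≤ᶜ : ∀ {a b} → a ≼ b → a ≤ᶜ b
≼⇒≤ᶜ (inj₁ p)        = inj₁ (≺⇒cmp≡lt p)
≼⇒≤ᶜ {a} (inj₂ refl) = inj₂ (cmp-refl a)

≼-total : ∀ a b → (a ≼ b) ⊎ (b ≺ a)
≼-total a b with cmp a b in e
... | lt = inj₁ (inj₁ (cmp≡lt e))
... | eq = inj₁ (inj₂ (cmp≡eq e))
... | gt = inj₂ (cmp≡gt e)

nf-head : ∀ {a b} → NF (ω^ a + b) → NF a
nf-head (nfω p _ _) = p

nf-tail : ∀ {a b} → NF (ω^ a + b) → NF b
nf-tail (nfω _ p _) = p

nf-lead : ∀ {a b} → NF (ω^ a + b) → LeadLe b a
nf-lead (nfω _ _ p) = p

leadLe⇒≼ : ∀ {a c d} → LeadLe (ω^ c + d) a → c ≼ a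
leadLe⇒≼ (leadω p) = ≤ᶜ⇒≼ p

leadLe-≺ : ∀ {x q p} → LeadLe q p → x ≺ q → LeadLe x p
leadLe-≺ _         𝟎≺ω       = lead𝟎
leadLe-≺ (leadω l) (head≺ r) = leadω (≼⇒≤ᶜ (≼-trans (inj₁ r) (≤ᶜ⇒≼ l)))
leadLe-≺ (leadω l) (tail≺ r) = leadω l

tail-≺ : ∀ {a b} → NF (ω^ a + b) → b ≺ ω^ a + b
tail-≺ {b = 𝟎} _ = 𝟎≺ω
tail-≺ {b = ω^ c + d} (nfω na (nfω _ nd l') l) with leadLe⇒≼ l
... | inj₁ c≺a  = head≺ c≺a
... | inj₂ refl = tail≺ (tail-≺ (nfω na nd l'))

⊕-absorb : ∀ {p q c d} → p ≺ c → (ω^ p + q) ⊕ (ω^ c + d) ≡ ω^ c + d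
⊕-absorb {p} {q} {c} {d} r rewrite ≺⇒cmp≡lt r = refl

⊕-keep : ∀ {p q c d} → c ≼ p → (ω^ p + q) ⊕ (ω^ c + d) ≡ ω^ p + (q ⊕ (ω^ c + d))
⊕-keep {p} {q} {c} {d} (inj₁ r)    rewrite ≺⇒cmp≡gt r = refl
⊕-keep {p} {q} {c} {d} (inj₂ refl) rewrite cmp-refl p = refl

data ⊕View (p q c d : Cnf) : Cnf → Set where
  absorbed : p ≺ c → ⊕View p q c d (ω^ c + d)
  kept     : c ≼ p → ⊕View p q c d (ω^ p + (q ⊕ (ω^ c + d)))

⊕-view : ∀ p q c d → ⊕View p q c d ((ω^ p + q) ⊕ (ω^ c + d))
⊕-view p q c d with ≼-total c p
... | inj₁ c≼p rewrite ⊕-keep {p} {q} {c} {d} c≼p = kept c≼p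
... | inj₂ p≺c rewrite ⊕-absorb {p} {q} {c} {d} p≺c = absorbed p≺c

⊕-identityʳ : ∀ x → x ⊕ 𝟎 ≡ x
⊕-identityʳ 𝟎          = refl
⊕-identityʳ (ω^ a + b) = refl

⊕-one : ∀ a a' → (ω^ a + a') ⊕ one ≡ ω^ a + (a' ⊕ one)
⊕-one a a' = ⊕-keep 𝟎≼

leadLe-⊕ : ∀ {u z a} → LeadLe u a → LeadLe z a → LeadLe (u ⊕ z) a
leadLe-⊕ {𝟎} lu lz = lz
leadLe-⊕ {ω^ p + q} {𝟎} lu lz = lu
leadLe-⊕ {ω^ p + q} {ω^ c + d} lu lz with (ω^ p + q) ⊕ (ω^ c + d) | ⊕-view p q c d
... | _ | absorbed _ = lz
... | _ | kept _     = leadω (≼⇒≤ᶜ (leadLe⇒≼ lu))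

NF-⊕ : ∀ {x z} → NF x → NF z → NF (x ⊕ z)
NF-⊕ {𝟎} nx nz = nz
NF-⊕ {ω^ p + q} {𝟎} nx nz = nx
NF-⊕ {ω^ p + q} {ω^ c + d} nx nz with (ω^ p + q) ⊕ (ω^ c + d) | ⊕-view p q c d
... | _ | absorbed _ = nz
... | _ | kept c≼p   =
  nfω (nf-head nx) (NF-⊕ (nf-tail nx) nz) (leadLe-⊕ (nf-lead nx) (leadω (≼⇒≤ᶜ c≼p)))

NF-ωp : ∀ {e} → NF e → NF (ωp e)
NF-ωp ne = nfω ne nf𝟎 lead𝟎

NF-one : NF one
NF-one = NF-ωp nf𝟎

x≼x⊕z : ∀ x z → x ≼ x ⊕ z
x≼x⊕z 𝟎 z = 𝟎≼
x≼x⊕z (ω^ p + q) 𝟎 = ≼-refl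
x≼x⊕z (ω^ p + q) (ω^ c + d) with (ω^ p + q) ⊕ (ω^ c + d) | ⊕-view p q c d
... | _ | absorbed p≺c = inj₁ (head≺ p≺c)
... | _ | kept _ with x≼x⊕z q (ω^ c + d)
...   | inj₁ s = inj₁ (tail≺ s)
...   | inj₂ s = inj₂ (cong (ω^ p +_) s)

x≺x⊕ω : ∀ x c d → x ≺ x ⊕ (ω^ c + d)
x≺x⊕ω 𝟎 c d = 𝟎≺ω
x≺x⊕ω (ω^ p + q) c d with (ω^ p + q) ⊕ (ω^ c + d) | ⊕-view p q c d
... | _ | absorbed p≺c = head≺ p≺c
... | _ | kept _       = tail≺ (x≺x⊕ω q c d)

x≺x⊕one : ∀ x → x ≺ x ⊕ one
x≺x⊕one x = x≺x⊕ω x 𝟎 𝟎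

z≼x⊕z : ∀ x z → NF z → z ≼ x ⊕ z
z≼x⊕z 𝟎 z _ = ≼-refl
z≼x⊕z (ω^ p + q) 𝟎 _ = 𝟎≼
z≼x⊕z (ω^ p + q) (ω^ c + d) nz with (ω^ p + q) ⊕ (ω^ c + d) | ⊕-view p q c d
... | _ | absorbed _        = ≼-refl
... | _ | kept (inj₁ c≺p)   = inj₁ (head≺ c≺p)
... | _ | kept (inj₂ refl)  = inj₁ (tail≺ (≺-≼-trans (tail-≺ nz) (z≼x⊕z q (ω^ c + d) nz)))

⊕-monoʳ-≺ : ∀ x {z z'} → z ≺ z' → x ⊕ z ≺ x ⊕ z'
⊕-monoʳ-≺ 𝟎 r = r
⊕-monoʳ-≺ (ω^ p + q) {𝟎} {ω^ c' + d'} _ = x≺x⊕ω (ω^ p + q) c' d'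
⊕-monoʳ-≺ (ω^ p + q) {ω^ c + d} {ω^ c' + d'} r
  with (ω^ p + q) ⊕ (ω^ c + d) | ⊕-view p q c d | (ω^ p + q) ⊕ (ω^ c' + d') | ⊕-view p q c' d'
... | _ | absorbed _   | _ | absorbed _    = r
... | _ | absorbed p≺c | _ | kept c'≼p     = contradiction (≺-≼-trans p≺c (head≼ r)) (≼⇒≯ c'≼p)
... | _ | kept _       | _ | absorbed p≺c' = head≺ p≺c'
... | _ | kept _       | _ | kept _        = tail≺ (⊕-monoʳ-≺ q r)

⊕-monoʳ-≼ : ∀ x {z z'} → z ≼ z' → x ⊕ z ≼ x ⊕ z'
⊕-monoʳ-≼ x (inj₁ r)    = inj₁ (⊕-monoʳ-≺ x r)
⊕-monoʳ-≼ x (inj₂ refl) = ≼-refl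

⊕-monoˡ-≺ : ∀ {x x'} z → NF z → x ≺ x' → x ⊕ z ≼ x' ⊕ z
⊕-monoˡ-≺ {x} {x'} 𝟎 _ r rewrite ⊕-identityʳ x | ⊕-identityʳ x' = inj₁ r
⊕-monoˡ-≺ {x' = x'} (ω^ c + d) nz 𝟎≺ω = z≼x⊕z x' _ nz
⊕-monoˡ-≺ {ω^ a + a'} {ω^ b + b'} (ω^ c + d) nz (head≺ a≺b)
  with (ω^ a + a') ⊕ (ω^ c + d) | ⊕-view a a' c d
... | _ | absorbed _ = z≼x⊕z (ω^ b + b') _ nz
... | _ | kept c≼a rewrite ⊕-keep {b} {b'} {c} {d} (inj₁ (≼-≺-trans c≼a a≺b)) = inj₁ (head≺ a≺b)
⊕-monoˡ-≺ {ω^ a + a'} {ω^ a + b'} (ω^ c + d) nz (tail≺ r)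
  with (ω^ a + a') ⊕ (ω^ c + d) | ⊕-view a a' c d | (ω^ a + b') ⊕ (ω^ c + d) | ⊕-view a b' c d
... | _ | absorbed _ | _ | absorbed _ = ≼-refl
... | _ | kept c≼a   | _ | absorbed a≺c = contradiction a≺c (≼⇒≯ c≼a)
... | _ | absorbed a≺c | _ | kept c≼a = contradiction a≺c (≼⇒≯ c≼a)
... | _ | kept _     | _ | kept _ with ⊕-monoˡ-≺ (ω^ c + d) nz r
...   | inj₁ u = inj₁ (tail≺ u)
...   | inj₂ u = inj₂ (cong (ω^ a +_) u)

⊕-monoˡ-≼ : ∀ {x x'} z → NF z → x ≼ x' → x ⊕ z ≼ x' ⊕ z
⊕-monoˡ-≼ z nz (inj₁ r)    = ⊕-monoˡ-≺ z nz r
⊕-monoˡ-≼ z nz (inj₂ refl) = ≼-refl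

⊕-mono-≼ : ∀ {x x' z z'} → NF z' → x ≼ x' → z ≼ z' → x ⊕ z ≼ x' ⊕ z'
⊕-mono-≼ {x} nz' p q = ≼-trans (⊕-monoʳ-≼ x q) (⊕-monoˡ-≼ _ nz' p)

ωp-mono-≺ : ∀ {y y'} → y ≺ y' → ωp y ≺ ωp y'
ωp-mono-≺ = head≺

ωp-mono-≼ : ∀ {y y'} → y ≼ y' → ωp y ≼ ωp y'
ωp-mono-≼ (inj₁ r)    = inj₁ (ωp-mono-≺ r)
ωp-mono-≼ (inj₂ refl) = ≼-refl

ωp≼ω^+ : ∀ {y p q} → y ≼ p → ωp y ≼ ω^ p + q
ωp≼ω^+ {q = q} (inj₁ r)             = inj₁ (head≺ r)
ωp≼ω^+ {q = 𝟎} (inj₂ refl)          = ≼-refl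
ωp≼ω^+ {q = ω^ _ + _} (inj₂ refl)   = inj₁ (tail≺ 𝟎≺ω)

ℓ-⊕ : ∀ x c d → ℓ (x ⊕ (ω^ c + d)) ≡ ℓ (ω^ c + d)
ℓ-⊕ 𝟎 c d = refl
ℓ-⊕ (ω^ p + q) c d with (ω^ p + q) ⊕ (ω^ c + d) | ⊕-view p q c d
... | _ | absorbed _ = refl
... | _ | kept _ with q ⊕ (ω^ c + d) | ℓ-⊕ q c d | x≺x⊕ω q c d
...   | ω^ _ + _ | ℓ-tail | _ = ℓ-tail

ℓ-⊕ωp : ∀ x e → ℓ (x ⊕ ωp e) ≡ e
ℓ-⊕ωp x e = ℓ-⊕ x e 𝟎

ℓ≼head : ∀ {p q} → NF (ω^ p + q) → ℓ (ω^ p + q) ≼ p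
ℓ≼head {q = 𝟎} _ = ≼-refl
ℓ≼head {q = ω^ c + d} n = ≼-trans (ℓ≼head (nf-tail n)) (leadLe⇒≼ (nf-lead n))

⊕one-least : ∀ {x y} → x ≺ y → x ⊕ one ≼ y
⊕one-least {𝟎} {ω^ 𝟎 + 𝟎} 𝟎≺ω = ≼-refl
⊕one-least {𝟎} {ω^ 𝟎 + (ω^ _ + _)} 𝟎≺ω = inj₁ (tail≺ 𝟎≺ω)
⊕one-least {𝟎} {ω^ (ω^ _ + _) + _} 𝟎≺ω = inj₁ (head≺ 𝟎≺ω)
⊕one-least {ω^ a + a'} (head≺ r) rewrite ⊕-one a a' = inj₁ (head≺ r)
⊕one-least {ω^ a + a'} (tail≺ r) rewrite ⊕-one a a' with ⊕one-least r
... | inj₁ u = inj₁ (tail≺ u)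
... | inj₂ u = inj₂ (cong (ω^ a +_) u)

≺⊕one⇒≼ : ∀ {x y} → y ≺ x ⊕ one → y ≼ x
≺⊕one⇒≼ {x} {y} r with ≼-total y x
... | inj₁ y≼x = y≼x
... | inj₂ x≺y = contradiction r (≼⇒≯ (⊕one-least x≺y))

-- y ≤ ω^y (no normal form is its own leading exponent).
y≼ωpy : ∀ {y} → NF y → y ≼ ωp y
y≼ωpy {𝟎} _ = 𝟎≼
y≼ωpy {ω^ a + b} n =
  inj₁ (head≺ (≼∧≢⇒≺ (≼-trans (y≼ωpy (nf-head n)) (ωp≼ω^+ ≼-refl)) (head≢ a b)))
  where
  head≢ : ∀ a b → a ≢ ω^ a + b
  head≢ (ω^ a' + b') b e = head≢ a' b' (cong leading e)
    where leading : Cnf → Cnf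
          leading 𝟎          = 𝟎
          leading (ω^ u + _) = u

succView-cons : ∀ p u v →
  succView (ω^ p + (ω^ u + v)) ≡ map (ω^ p +_) (succView (ω^ u + v))
succView-cons 𝟎 u v with succView (ω^ u + v)
... | just _  = refl
... | nothing = refl
succView-cons (ω^ _ + _) u v with succView (ω^ u + v)
... | just _  = refl
... | nothing = refl

succView-⊕one : ∀ e → succView (e ⊕ one) ≡ just e
succView-⊕one 𝟎 = refl
succView-⊕one (ω^ p + q) rewrite ⊕-one p q with q ⊕ one | succView-⊕one q
... | ω^ u + v | ih rewrite succView-cons p u v | ih = refl

succView-just : ∀ {c δ} → succView c ≡ just δ → c ≡ δ ⊕ one
succView-just {ω^ 𝟎 + 𝟎} refl = refl
succView-just {ω^ a + (ω^ u + v)} sv rewrite succView-cons a u v with succView (ω^ u + v) in e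
succView-just {ω^ a + (ω^ u + v)} refl | just δ' rewrite ⊕-one a δ' = cong (ω^ a +_) (succView-just e)

limit-⊕one : ∀ {c e} → succView c ≡ nothing → e ≺ c → e ⊕ one ≺ c
limit-⊕one {c} {e} sv r with ⊕one-least r
... | inj₁ u = u
... | inj₂ refl with () ← trans (sym (succView-⊕one e)) sv

NF-pred : ∀ {δ} → NF (δ ⊕ one) → NF δ
NF-pred {𝟎} _ = nf𝟎
NF-pred {ω^ p + q} n rewrite ⊕-one p q =
  nfω (nf-head n) (NF-pred (nf-tail n)) (leadLe-pred (nf-lead n))
  where
  leadLe-pred : ∀ {q p} → LeadLe (q ⊕ one) p → LeadLe q p
  leadLe-pred {𝟎} _ = lead𝟎
  leadLe-pred {ω^ r + s} l rewrite ⊕-one r s with l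
  ... | leadω x = leadω x

⊕ωp-≼ : ∀ {x a y} → NF a → x ≺ a → y ≼ ℓ a → x ⊕ ωp y ≼ a
⊕ωp-≼ {𝟎} na 𝟎≺ω y≼ℓa = ωp≼ω^+ (≼-trans y≼ℓa (ℓ≼head na))
⊕ωp-≼ {ω^ s + t} {y = y} na (head≺ s≺p) y≼ℓa with (ω^ s + t) ⊕ ωp y | ⊕-view s t y 𝟎
... | _ | absorbed _ = ωp≼ω^+ (≼-trans y≼ℓa (ℓ≼head na))
... | _ | kept _     = inj₁ (head≺ s≺p)
⊕ωp-≼ {ω^ s + t} {ω^ s + (ω^ c + d)} {y} na (tail≺ t≺q) y≼ℓa
  rewrite ⊕-keep {s} {t} {y} {𝟎} (≼-trans y≼ℓa (ℓ≼head na))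
  with ⊕ωp-≼ {t} {ω^ c + d} {y} (nf-tail na) t≺q y≼ℓa
... | inj₁ u = inj₁ (tail≺ u)
... | inj₂ u = inj₂ (cong (ω^ s +_) u)

zero-or-below : ∀ {x c d} → x ≡ 𝟎 ⊎ x ≺ ω^ c + d → x ≺ ω^ c + d
zero-or-below (inj₁ refl) = 𝟎≺ω
zero-or-below (inj₂ r)    = r

-- If ℓ(a) < e, the terms of a below ω^e are absorbed by ω^e:
-- a + ω^e = x₀ + ω^e for some x₀ that is 0 or smaller than a.
absorbing-prefix : ∀ {a e} → NF a → ℓ a ≺ e →
  Σ Cnf λ x₀ → NF x₀ × (x₀ ≡ 𝟎 ⊎ x₀ ≺ a) × (x₀ ⊕ ωp e ≡ a ⊕ ωp e)
absorbing-prefix {𝟎} _ _ = 𝟎 , nf𝟎 , inj₁ refl , refl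
absorbing-prefix {ω^ p + 𝟎} _ p≺e = 𝟎 , nf𝟎 , inj₁ refl , sym (⊕-absorb p≺e)
absorbing-prefix {ω^ p + (ω^ c + d)} {e} na@(nfω _ n-tail _) ℓa≺e
  with (ω^ p + (ω^ c + d)) ⊕ ωp e | ⊕-view p (ω^ c + d) e 𝟎
... | _ | absorbed _ = 𝟎 , nf𝟎 , inj₁ refl , refl
... | _ | kept e≼p with absorbing-prefix n-tail ℓa≺e
...   | x₁ , nx₁ , x₁-small , x₁-eq =
  ω^ p + x₁ , nfω (nf-head na) nx₁ (leadLe-≺ (nf-lead na) (zero-or-below x₁-small)) ,
  inj₂ (tail≺ (zero-or-below x₁-small)) , trans (⊕-keep e≼p) (cong (ω^ p +_) x₁-eq)

last-term-split : ∀ {a} → NF a → 𝟎 ≺ a → Σ Cnf λ x₀ → NF x₀ × x₀ ≺ a × x₀ ⊕ ωp (ℓ a) ≡ a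
last-term-split {ω^ p + 𝟎} _ _ = 𝟎 , nf𝟎 , 𝟎≺ω , refl
last-term-split {ω^ p + (ω^ c + d)} na _ with last-term-split (nf-tail na) 𝟎≺ω
... | x₁ , nx₁ , x₁≺q , x₁-eq =
  ω^ p + x₁ , nfω (nf-head na) nx₁ (leadLe-≺ (nf-lead na) x₁≺q) , tail≺ x₁≺q ,
  trans (⊕-keep (ℓ≼head na)) (cong (ω^ p +_) x₁-eq)

-- Continuity of x + ω^c at a limit c: anything below x + ω^c lies below
-- x + ω^e′ for some e′ < c.
limit-approx-ωp : ∀ {s c} → NF s → succView c ≡ nothing → 𝟎 ≺ c → s ≺ ωp c →
  Σ Cnf λ e′ → NF e′ × e′ ≺ c × s ≺ ωp e′
limit-approx-ωp {𝟎} _ _ 𝟎≺c _ = 𝟎 , nf𝟎 , 𝟎≺c , 𝟎≺ω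
limit-approx-ωp {ω^ f + g} ns sv _ (head≺ f≺c) =
  f ⊕ one , NF-⊕ (nf-head ns) NF-one , limit-⊕one sv f≺c , head≺ (x≺x⊕one f)

limit-approx : ∀ {x s c} → NF s → succView c ≡ nothing → 𝟎 ≺ c → s ≺ x ⊕ ωp c →
  Σ Cnf λ e′ → NF e′ × e′ ≺ c × s ≺ x ⊕ ωp e′
limit-approx {𝟎} = limit-approx-ωp
limit-approx {ω^ p + q} {s} {c} ns sv 𝟎≺c s≺ with (ω^ p + q) ⊕ ωp c | ⊕-view p q c 𝟎
... | _ | absorbed _ with limit-approx-ωp ns sv 𝟎≺c s≺
...   | e′ , ne′ , e′≺c , s≺′ = e′ , ne′ , e′≺c , ≺-≼-trans s≺′ (z≼x⊕z (ω^ p + q) _ (NF-ωp ne′))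
limit-approx {ω^ p + q} {s} {c} ns sv 𝟎≺c s≺ | _ | kept c≼p with s≺
... | 𝟎≺ω      = 𝟎 , nf𝟎 , 𝟎≺c , ≺-≼-trans 𝟎≺ω (x≼x⊕z (ω^ p + q) one)
... | head≺ r  = 𝟎 , nf𝟎 , 𝟎≺c , ≺-≼-trans (head≺ r) (x≼x⊕z (ω^ p + q) one)
... | tail≺ r with limit-approx {q} (nf-tail ns) sv 𝟎≺c r
...   | e′ , ne′ , e′≺c , r′ =
  e′ , ne′ , e′≺c , subst (s ≺_) (sym (⊕-keep (inj₁ (≺-≼-trans e′≺c c≼p)))) (tail≺ r′)

-- Countdown recursion: the sequences ◇ₙα, σₙ(α) and the meet of two
-- Ignatiev sequences are all computed from index n downwards by
--   f i = step i (f (i+1))  for i ≤ n,    f i = d  for i > n.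
module Countdown {A : Set} (step : ℕ → A → A) (d : A) where

  steps : ℕ → ℕ → A
  steps zero    i = step i d
  steps (suc k) i = step i (steps k (suc i))

  countdown : ℕ → ℕ → A
  countdown n i with i ≤? n
  ... | yes _ = steps (n ∸ i) i
  ... | no  _ = d

  countdown-above : ∀ {n i} → ¬ (i ≤ℕ n) → countdown n i ≡ d
  countdown-above {n} {i} i≰n with i ≤? n
  ... | yes i≤n = contradiction i≤n i≰n
  ... | no  _   = refl

  countdown-unfold : ∀ {n i} → i ≤ℕ n → countdown n i ≡ step i (countdown n (suc i))
  countdown-unfold {n} {i} i≤n with i ≤? n | suc i ≤? n
  ... | no i≰n | _ = contradiction i≤n i≰n
  ... | yes _ | yes i<n rewrite ℕ.+-∸-assoc 1 i<n = refl
  ... | yes _ | no i≮n rewrite ℕ.≤-antisym i≤n (ℕ.≤-pred (ℕ.≰⇒> i≮n)) | ℕ.n∸n≡0 n = refl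

  countdown-ind : ∀ {n} (P : ℕ → A → Set) →
    (∀ i → ¬ (i ≤ℕ n) → P i d) →
    (∀ i {y} → i ≤ℕ n → P (suc i) y → P i (step i y)) →
    ∀ i → P i (countdown n i)
  countdown-ind {n} P P-above P-step i =
    go (suc n) i (ℕ.≤-trans (ℕ.n<1+n n) (ℕ.m≤n+m (suc n) i))
    where
    above : ∀ {i} → ¬ (i ≤ℕ n) → P i (countdown n i)
    above i≰n = subst (P _) (sym (countdown-above i≰n)) (P-above _ i≰n)
    unfold : ∀ {i} → Dec (i ≤ℕ n) → P (suc i) (countdown n (suc i)) → P i (countdown n i)
    unfold (yes i≤n) next = subst (P _) (sym (countdown-unfold i≤n)) (P-step _ i≤n next)
    unfold (no i≰n)  _    = above i≰n
    go : ∀ k i → n <ℕ i + k → P i (countdown n i)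
    go zero    i n<i+0 = above (ℕ.<⇒≱ (subst (n <ℕ_) (ℕ.+-identityʳ i) n<i+0))
    go (suc k) i n<i+k = unfold (i ≤? n) (go k (suc i) (subst (n <ℕ_) (ℕ.+-suc i k) n<i+k))

countdown-ign : ∀ (step : ℕ → Cnf → Cnf) n → (∀ i y → y ≼ ℓ (step i y)) →
  let open Countdown step 𝟎 in ∀ i → countdown n (suc i) ≤ᶜ ℓ (countdown n i)
countdown-ign step n step-ℓ i = by-position (i ≤? n)
  where
  open Countdown step 𝟎
  by-position : Dec (i ≤ℕ n) → countdown n (suc i) ≤ᶜ ℓ (countdown n i)
  by-position (yes i≤n) = subst (λ v → countdown n (suc i) ≤ᶜ ℓ v) (sym (countdown-unfold i≤n))
    (≼⇒≤ᶜ (step-ℓ i (countdown n (suc i))))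
  by-position (no i≰n) = subst (λ v → v ≤ᶜ ℓ (countdown n i))
    (sym (countdown-above (λ i+1≤n → i≰n (ℕ.≤-trans (ℕ.n≤1+n i) i+1≤n))))
    (≼⇒≤ᶜ (𝟎≼ {ℓ (countdown n i)}))

height : Cnf → ℕ
height 𝟎          = 0
height (ω^ a + _) = suc (height a)

height-mono : ∀ {a b} → a ≼ b → height a ≤ℕ height b
height-mono (inj₂ refl)      = ℕ.≤-refl
height-mono (inj₁ 𝟎≺ω)       = z≤n
height-mono (inj₁ (head≺ r)) = s≤s (height-mono (inj₁ r))
height-mono (inj₁ (tail≺ _)) = ℕ.≤-refl

height-ℓ : ∀ {a} → NF a → height (ℓ a) ≤ℕ pred (height a)
height-ℓ {𝟎} _ = z≤n
height-ℓ {ω^ p + 𝟎} _ = ℕ.≤-refl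
height-ℓ {ω^ p + (ω^ c + d)} na =
  ℕ.≤-trans (height-ℓ (nf-tail na)) (height-mono (leadLe⇒≼ (nf-lead na)))

height-zero : ∀ {a} → height a ≤ℕ 0 → a ≡ 𝟎
height-zero {𝟎} _ = refl

-- The terms of an Ignatiev sequence lose height at every step,
-- so the sequence vanishes from index height(x₀) on.
height-step : ∀ (x : I) i → height (seq x (suc i)) ≤ℕ pred (height (seq x i))
height-step x i = ℕ.≤-trans (height-mono (≤ᶜ⇒≼ (ign x i))) (height-ℓ (nf x i))

vanishes-after : ∀ (x : I) k i → height (seq x i) ≤ℕ k → seq x (k + i) ≡ 𝟎
vanishes-after x zero    i h = height-zero h
vanishes-after x (suc k) i h =
  subst (λ j → seq x j ≡ 𝟎) (ℕ.+-suc k i)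
        (vanishes-after x k (suc i) (ℕ.≤-trans (height-step x i) (ℕ.pred-mono-≤ h)))

eventually-zero : ∀ (x : I) j → height (seq x 0) ≤ℕ j → seq x j ≡ 𝟎
eventually-zero x j h = subst (λ i → seq x i ≡ 𝟎) (ℕ.+-identityʳ j) (vanishes-after x j 0 h)

maxᶜ : Cnf → Cnf → Cnf
maxᶜ a b with ≼-total a b
... | inj₁ _ = b
... | inj₂ _ = a

maxᶜ-nf : ∀ {a b} → NF a → NF b → NF (maxᶜ a b)
maxᶜ-nf {a} {b} na nb with ≼-total a b
... | inj₁ _ = nb
... | inj₂ _ = na

maxᶜ-≼ˡ : ∀ a b → a ≼ maxᶜ a b
maxᶜ-≼ˡ a b with ≼-total a b
... | inj₁ a≼b = a≼b
... | inj₂ _   = ≼-refl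

maxᶜ-≼ʳ : ∀ a b → b ≼ maxᶜ a b
maxᶜ-≼ʳ a b with ≼-total a b
... | inj₁ _   = ≼-refl
... | inj₂ b≺a = inj₁ b≺a

maxᶜ-least : ∀ {a b w} → a ≼ w → b ≼ w → maxᶜ a b ≼ w
maxᶜ-least {a} {b} a≼w b≼w with ≼-total a b
... | inj₁ _ = b≼w
... | inj₂ _ = a≼w

-- meetStep g d is the least c ≥ g with d ≤ ℓ(c): g itself if d ≤ ℓ(g), else g + ω^d.
meetStep : Cnf → Cnf → Cnf
meetStep g d with ≼-total d (ℓ g)
... | inj₁ _ = g
... | inj₂ _ = g ⊕ ωp d

meetStep-nf : ∀ {g d} → NF g → NF d → NF (meetStep g d)
meetStep-nf {g} {d} ng nd with ≼-total d (ℓ g)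
... | inj₁ _ = ng
... | inj₂ _ = NF-⊕ ng (NF-ωp nd)

meetStep-≥ : ∀ g d → g ≼ meetStep g d
meetStep-≥ g d with ≼-total d (ℓ g)
... | inj₁ _ = ≼-refl
... | inj₂ _ = x≼x⊕z g _

meetStep-ℓ : ∀ g d → d ≼ ℓ (meetStep g d)
meetStep-ℓ g d with ≼-total d (ℓ g)
... | inj₁ d≼ℓg = d≼ℓg
... | inj₂ _    = inj₂ (sym (ℓ-⊕ωp g d))

meetStep-least : ∀ {g d w} → NF w → g ≼ w → d ≼ ℓ w → meetStep g d ≼ w
meetStep-least {g} {d} nw g≼w d≼ℓw with ≼-total d (ℓ g)
... | inj₁ _ = g≼w
... | inj₂ ℓg≺d with g≼w
...   | inj₁ g≺w  = ⊕ωp-≼ nw g≺w d≼ℓw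
...   | inj₂ refl = contradiction ℓg≺d (≼⇒≯ d≼ℓw)

-- The meet of two Ignatiev sequences: below the common vanishing bound,
-- δᵢ = meetStep (max αᵢ βᵢ) δᵢ₊₁; above it, δᵢ = 0.
module Meet (α β : I) where

  bound : ℕ
  bound = height (seq α 0) ⊔ height (seq β 0)

  open Countdown (λ i d → meetStep (maxᶜ (seq α i) (seq β i)) d) 𝟎

  meetSeq : Seq
  meetSeq = countdown bound

  meetSeq-nf : ∀ i → NF (meetSeq i)
  meetSeq-nf = countdown-ind (λ _ → NF) (λ _ _ → nf𝟎)
    (λ i _ nd → meetStep-nf (maxᶜ-nf (nf α i) (nf β i)) nd)

  meetSeq-ign : ∀ i → meetSeq (suc i) ≤ᶜ ℓ (meetSeq i)
  meetSeq-ign = countdown-ign _ bound (λ i y → meetStep-ℓ (maxᶜ (seq α i) (seq β i)) y)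

  meet : I
  meet = record { seq = meetSeq ; nf = meetSeq-nf ; ign = meetSeq-ign }

  below-meet : ∀ (x : I) → height (seq x 0) ≤ℕ bound → (∀ i → seq x i ≼ maxᶜ (seq α i) (seq β i)) →
    ∀ i → seq x i ≼ meetSeq i
  below-meet x x≤N x≼max = countdown-ind (λ i v → seq x i ≼ v)
    (λ i i≰N → inj₂ (eventually-zero x i (ℕ.≤-trans x≤N (ℕ.<⇒≤ (ℕ.≰⇒> i≰N)))))
    (λ i {y} _ _ → ≼-trans (x≼max i) (meetStep-≥ (maxᶜ (seq α i) (seq β i)) y))

  α≼meet : ∀ i → seq α i ≼ meetSeq i
  α≼meet = below-meet α (ℕ.m≤m⊔n _ _) (λ i → maxᶜ-≼ˡ (seq α i) (seq β i))

  β≼meet : ∀ i → seq β i ≼ meetSeq i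
  β≼meet = below-meet β (ℕ.m≤n⊔m _ _) (λ i → maxᶜ-≼ʳ (seq α i) (seq β i))

  meet-greatest : ∀ (w : I) → (∀ i → seq α i ≼ seq w i) → (∀ i → seq β i ≼ seq w i) →
    ∀ i → meetSeq i ≼ seq w i
  meet-greatest w α≼w β≼w = countdown-ind (λ i v → v ≼ seq w i) (λ _ _ → 𝟎≼)
    (λ i _ next → meetStep-least (nf w i) (maxᶜ-least (α≼w i) (β≼w i))
                                  (≼-trans next (≤ᶜ⇒≼ (ign w i))))

  isMeet : IsMeet α β meet
  isMeet = (λ i → ≼⇒≤ᶜ (α≼meet i)) , (λ i → ≼⇒≤ᶜ (β≼meet i)) ,
           (λ w w≤α w≤β i → ≼⇒≤ᶜ (meet-greatest w (λ j → ≤ᶜ⇒≼ (w≤α j)) (λ j → ≤ᶜ⇒≼ (w≤β j)) i))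

filter-directed : ∀ {G : I → Set} → IsFilter G → ∀ {γ γ′} → G γ → G γ′ →
  Σ I λ δ → G δ × (∀ i → seq γ i ≼ seq δ i) × (∀ i → seq γ′ i ≼ seq δ i)
filter-directed {G} isF {γ} {γ′} γ∈G γ′∈G =
  meet , IsFilter.meet isF γ γ′ meet γ∈G γ′∈G isMeet , α≼meet , β≼meet
  where open Meet γ γ′

fin-≼ : ∀ {a b} → a ≼ b → fin a ≤⁺ fin b
fin-≼ p = fin≤fin (≼⇒≤ᶜ p)

fin-≼⁻ : ∀ {a b} → fin a ≤⁺ fin b → a ≼ b
fin-≼⁻ {a} {b} (fin≤fin p) = ≤ᶜ⇒≼ {a} {b} p

≤⁺-trans : ∀ {a b c} → a ≤⁺ b → b ≤⁺ c → a ≤⁺ c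
≤⁺-trans p@(fin≤fin _) q@(fin≤fin _) = fin-≼ (≼-trans (fin-≼⁻ p) (fin-≼⁻ q))
≤⁺-trans (fin≤fin _) fin≤ε₀ = fin≤ε₀
≤⁺-trans fin≤ε₀      ε₀≤ε₀  = fin≤ε₀
≤⁺-trans ε₀≤ε₀       ε₀≤ε₀  = ε₀≤ε₀

≤⁺-antisym : ∀ {a b} → a ≤⁺ b → b ≤⁺ a → a ≡ b
≤⁺-antisym p@(fin≤fin _) q@(fin≤fin _) = cong fin (≼-antisym (fin-≼⁻ p) (fin-≼⁻ q))
≤⁺-antisym ε₀≤ε₀ ε₀≤ε₀ = refl

≤⁺-ε₀ : ∀ o → o ≤⁺ ε₀
≤⁺-ε₀ (fin _) = fin≤ε₀
≤⁺-ε₀ ε₀      = ε₀≤ε₀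

nfFin⁻ : ∀ {a} → NF⁺ (fin a) → NF a
nfFin⁻ (nfFin n) = n

-- o = sup{f t + 1 : P t} for a family of normal forms indexed by any type;
-- IsSupSucc F i is the instance t ↦ tᵢ over the members of F.
IsSupOfSuccs : {T : Set} → (T → Set) → (T → Cnf) → Ord⁺ → Set
IsSupOfSuccs {T} P f o =
  NF⁺ o × (∀ (t : T) → P t → fin (f t ⊕ one) ≤⁺ o)
        × (∀ (o′ : Ord⁺) → NF⁺ o′ → (∀ (t : T) → P t → fin (f t ⊕ one) ≤⁺ o′) → o ≤⁺ o′)

IsSupOfSuccs-cong : ∀ {T : Set} {P : T → Set} {f g : T → Cnf} {o} →
  (∀ t → f t ≡ g t) → IsSupOfSuccs P f o → IsSupOfSuccs P g o
IsSupOfSuccs-cong {P = P} {o = o} f≗g (n , upper , least) =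
  n , (λ t pt → subst (λ z → fin (z ⊕ one) ≤⁺ o) (f≗g t) (upper t pt)) ,
  (λ o′ no′ up′ → least o′ no′ (λ t pt → subst (λ z → fin (z ⊕ one) ≤⁺ o′) (sym (f≗g t)) (up′ t pt)))

module SupFacts {T : Set} (P : T → Set) where

  member-below : ∀ (f : T → Cnf) {a t} → IsSupOfSuccs P f (fin a) → P t → f t ≺ a
  member-below f {t = t} (_ , upper , _) pt = ≺-≼-trans (x≺x⊕one (f t)) (fin-≼⁻ (upper t pt))

  reached : ∀ (f : T → Cnf) {a x₀} → IsSupOfSuccs P f (fin a) → NF x₀ → x₀ ≺ a →
    ¬ ¬ (Σ T λ t → P t × x₀ ≼ f t)
  reached f {a} {x₀} (_ , _ , least) nx₀ x₀≺a unreached =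
    ≼⇒≯ (fin-≼⁻ (least (fin x₀) (nfFin nx₀) x₀-bounds)) x₀≺a
    where
    x₀-bounds : ∀ t → P t → fin (f t ⊕ one) ≤⁺ fin x₀
    x₀-bounds t pt with ≼-total x₀ (f t)
    ... | inj₁ x₀≼ft = contradiction (t , pt , x₀≼ft) unreached
    ... | inj₂ ft≺x₀ = fin-≼ (⊕one-least ft≺x₀)

  reached-or-zero : ∀ (f : T → Cnf) {a x₀} → Σ T P → IsSupOfSuccs P f (fin a) → NF x₀ →
    x₀ ≡ 𝟎 ⊎ x₀ ≺ a → ¬ ¬ (Σ T λ t → P t × x₀ ≼ f t)
  reached-or-zero f (t , pt) _ _ (inj₁ refl) unreached = unreached (t , pt , 𝟎≼)
  reached-or-zero f _ sup nx₀ (inj₂ x₀≺a) = reached f sup nx₀ x₀≺a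

  sup-≡ : ∀ (f : T → Cnf) {S v} → IsSupOfSuccs P f S → NF⁺ v →
    (∀ t → P t → fin (f t ⊕ one) ≤⁺ v) → v ≤⁺ S → S ≡ v
  sup-≡ f (_ , _ , least) nv v-upper v≤S = ≤⁺-antisym (least _ nv v-upper) v≤S

  sup-≥ : ∀ (f : T → Cnf) {S w} → IsSupOfSuccs P f S →
    (∀ s → NF s → s ≺ w → ¬ (∀ t → P t → f t ⊕ one ≼ s)) → fin w ≤⁺ S
  sup-≥ f {ε₀} _ _ = fin≤ε₀
  sup-≥ f {fin s} {w} (ns , upper , _) no-bound with ≼-total w s
  ... | inj₁ w≼s = fin-≼ w≼s
  ... | inj₂ s≺w = contradiction (λ t pt → fin-≼⁻ (upper t pt)) (no-bound s (nfFin⁻ ns) s≺w)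

  sup-const : ∀ {c o} → NF c → Σ T P → IsSupOfSuccs P (λ _ → c) o → o ≡ fin (c ⊕ one)
  sup-const nc (t , pt) (_ , upper , least) =
    ≤⁺-antisym (least _ (nfFin (NF-⊕ nc NF-one)) (λ _ _ → fin-≼ ≼-refl)) (upper t pt)

  sup-mono : ∀ (f g : T → Cnf) {A S} → (∀ t → f t ⊕ one ≼ g t ⊕ one) →
    IsSupOfSuccs P f A → IsSupOfSuccs P g S → A ≤⁺ S
  sup-mono f g f≼g (_ , _ , leastA) (nS , upperS , _) =
    leastA _ nS (λ t pt → ≤⁺-trans (fin-≼ (f≼g t)) (upperS t pt))

module SupOfSums {T : Set} (P : T → Set) (X Y : T → Cnf) (nonempty : Σ T P)
  (directed : ∀ {t t′} → P t → P t′ → Σ T λ t″ → P t″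
              × X t ≼ X t″ × X t′ ≼ X t″ × Y t ≼ Y t″ × Y t′ ≼ Y t″)
  (nX : ∀ t → NF (X t)) (nY : ∀ t → NF (Y t)) where

  Sum : T → Cnf
  Sum t = X t ⊕ ωp (Y t)

  open SupFacts P

  A≤S : ∀ {A S} → IsSupOfSuccs P X A → IsSupOfSuccs P Sum S → A ≤⁺ S
  A≤S = sup-mono X Sum (λ t → ⊕-monoˡ-≼ one NF-one (x≼x⊕z (X t) _))

  B≤S : ∀ {B S} → IsSupOfSuccs P Y B → IsSupOfSuccs P Sum S → B ≤⁺ S
  B≤S = sup-mono Y Sum (λ t → ⊕-monoˡ-≼ one NF-one
                          (≼-trans (y≼ωpy (nY t)) (z≼x⊕z (X t) _ (NF-ωp (nY t)))))

  -- If x₀ and e′ are both reached, then x₀ + ω^e′ + 1 ≤ Sum t + 1 for a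
  -- common dominating member t, so nothing ≤ x₀ + ω^e′ bounds all Sum t + 1.
  reached-sum-unbounded : ∀ {s x₀ e′} → (∀ t → P t → Sum t ⊕ one ≼ s) → s ≼ x₀ ⊕ ωp e′ →
    ¬ ¬ (Σ T λ t → P t × x₀ ≼ X t) → ¬ ¬ (Σ T λ t → P t × e′ ≼ Y t) → ⊥
  reached-sum-unbounded s-bounds s≼ x₀-reached e′-reached =
    x₀-reached λ (t₁ , p₁ , x₀≼X) → e′-reached λ (t₂ , p₂ , e′≼Y) →
      let (t , pt , X₁≼ , _ , _ , Y₂≼) = directed p₁ p₂
          s≼Sum = ≼-trans s≼ (⊕-mono-≼ (NF-ωp (nY t)) (≼-trans x₀≼X X₁≼) (ωp-mono-≼ (≼-trans e′≼Y Y₂≼)))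
      in ≺-irrefl (≼-≺-trans s≼Sum (≺-≼-trans (x≺x⊕one (Sum t)) (s-bounds t pt)))

  -- Case B ≤ ℓ(A): the summands ω^(Y t) are swallowed and the supremum is A.
  sup-B≤ℓA : ∀ {a b S} → IsSupOfSuccs P X (fin a) → IsSupOfSuccs P Y (fin b) →
    IsSupOfSuccs P Sum S → b ≼ ℓ a → S ≡ fin a
  sup-B≤ℓA {a} supA supB supS b≼ℓa = sup-≡ Sum supS (proj₁ supA) upper (A≤S supA supS)
    where
    upper : ∀ t → P t → fin (Sum t ⊕ one) ≤⁺ fin a
    upper t pt = fin-≼ (⊕one-least (≺-≼-trans
      (⊕-monoʳ-≺ (X t) (ωp-mono-≺ (≺-≼-trans (member-below Y supB pt) b≼ℓa)))
      (⊕ωp-≼ (nfFin⁻ (proj₁ supA)) (member-below X supA pt) ≼-refl)))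

  sup-A=ε₀ : ∀ {S} → IsSupOfSuccs P X ε₀ → IsSupOfSuccs P Sum S → S ≡ ε₀
  sup-A=ε₀ supA supS = ≤⁺-antisym (≤⁺-ε₀ _) (A≤S supA supS)

  sup-B=ε₀ : ∀ {S} → IsSupOfSuccs P Y ε₀ → IsSupOfSuccs P Sum S → S ≡ ε₀
  sup-B=ε₀ {ε₀} _ _ = refl
  sup-B=ε₀ {fin _} supB supS with () ← B≤S supB supS

  sup-B-limit : ∀ {a c S} → IsSupOfSuccs P X (fin a) → IsSupOfSuccs P Y (fin c) →
    IsSupOfSuccs P Sum S → ℓ a ≺ c → succView c ≡ nothing → S ≡ fin (a ⊕ ωp c)
  sup-B-limit {a} {c} supA supB supS ℓa≺c c-limit =
    sup-≡ Sum supS (nfFin (NF-⊕ na (NF-ωp nc))) upper (sup-≥ Sum supS no-bound)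
    where
    na : NF a
    na = nfFin⁻ (proj₁ supA)
    nc : NF c
    nc = nfFin⁻ (proj₁ supB)
    𝟎≺c : 𝟎 ≺ c
    𝟎≺c = ≼-≺-trans 𝟎≼ ℓa≺c
    -- Sum t + 1 ≤ X t + ω^(Y t + 1) < X t + ω^c ≤ a + ω^c.
    upper : ∀ t → P t → fin (Sum t ⊕ one) ≤⁺ fin (a ⊕ ωp c)
    upper t pt = fin-≼ (≼-trans (⊕one-least (⊕-monoʳ-≺ (X t) (ωp-mono-≺ (x≺x⊕one (Y t)))))
      (inj₁ (≺-≼-trans (⊕-monoʳ-≺ (X t) (ωp-mono-≺ (limit-⊕one c-limit (member-below Y supB pt))))
                       (⊕-monoˡ-≼ (ωp c) (NF-ωp nc) (inj₁ (member-below X supA pt))))))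
    no-bound : ∀ s → NF s → s ≺ a ⊕ ωp c → ¬ (∀ t → P t → Sum t ⊕ one ≼ s)
    no-bound s ns s≺ s-bounds with absorbing-prefix na ℓa≺c
    ... | x₀ , nx₀ , x₀-small , x₀-sum
      with limit-approx {x₀} ns c-limit 𝟎≺c (subst (s ≺_) (sym x₀-sum) s≺)
    ...   | e′ , ne′ , e′≺c , s≺′ =
      reached-sum-unbounded s-bounds (inj₁ s≺′)
        (reached-or-zero X nonempty supA nx₀ x₀-small) (reached Y supB ne′ e′≺c)

  sup-B-succ-above : ∀ {a c δ S} → IsSupOfSuccs P X (fin a) → IsSupOfSuccs P Y (fin c) →
    IsSupOfSuccs P Sum S → c ≡ δ ⊕ one → ℓ a ≺ δ → S ≡ fin ((a ⊕ ωp δ) ⊕ one)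
  sup-B-succ-above {a} {c} {δ} supA supB supS refl ℓa≺δ =
    sup-≡ Sum supS (nfFin (NF-⊕ (NF-⊕ na (NF-ωp nδ)) NF-one)) upper (sup-≥ Sum supS no-bound)
    where
    na : NF a
    na = nfFin⁻ (proj₁ supA)
    nδ : NF δ
    nδ = NF-pred (nfFin⁻ (proj₁ supB))
    upper : ∀ t → P t → fin (Sum t ⊕ one) ≤⁺ fin ((a ⊕ ωp δ) ⊕ one)
    upper t pt = fin-≼ (⊕-monoˡ-≼ one NF-one (⊕-mono-≼ (NF-ωp nδ) (inj₁ (member-below X supA pt))
                   (ωp-mono-≼ (≺⊕one⇒≼ (member-below Y supB pt)))))
    no-bound : ∀ s → NF s → s ≺ (a ⊕ ωp δ) ⊕ one → ¬ (∀ t → P t → Sum t ⊕ one ≼ s)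
    no-bound s ns s≺ s-bounds with absorbing-prefix na ℓa≺δ
    ... | x₀ , nx₀ , x₀-small , x₀-sum =
      reached-sum-unbounded s-bounds (subst (s ≼_) (sym x₀-sum) (≺⊕one⇒≼ s≺))
        (reached-or-zero X nonempty supA nx₀ x₀-small) (reached Y supB nδ (x≺x⊕one δ))

  sup-B-succ-at : ∀ {a c δ S} → IsSupOfSuccs P X (fin a) → IsSupOfSuccs P Y (fin c) →
    IsSupOfSuccs P Sum S → c ≡ δ ⊕ one → ℓ a ≡ δ → S ≡ fin (a ⊕ one)
  sup-B-succ-at {a} {c} {δ} supA supB supS refl refl =
    sup-≡ Sum supS (nfFin (NF-⊕ na NF-one)) upper (sup-≥ Sum supS no-bound)
    where
    na : NF a
    na = nfFin⁻ (proj₁ supA)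
    nδ : NF δ
    nδ = NF-pred (nfFin⁻ (proj₁ supB))
    upper : ∀ t → P t → fin (Sum t ⊕ one) ≤⁺ fin (a ⊕ one)
    upper t pt = fin-≼ (⊕-monoˡ-≼ one NF-one
      (⊕ωp-≼ na (member-below X supA pt) (≺⊕one⇒≼ (member-below Y supB pt))))
    𝟎≺a : 𝟎 ≺ a
    𝟎≺a = ≼-≺-trans 𝟎≼ (member-below X supA (proj₂ nonempty))
    no-bound : ∀ s → NF s → s ≺ a ⊕ one → ¬ (∀ t → P t → Sum t ⊕ one ≼ s)
    no-bound s ns s≺ s-bounds with last-term-split na 𝟎≺a
    ... | x₀ , nx₀ , x₀≺a , x₀-sum =
      reached-sum-unbounded s-bounds (subst (s ≼_) (sym x₀-sum) (≺⊕one⇒≼ s≺))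
        (reached X supA nx₀ x₀≺a) (reached Y supB nδ (x≺x⊕one (ℓ a)))

  sup-of-sums : ∀ {A B S} → IsSupOfSuccs P X A → IsSupOfSuccs P Y B → IsSupOfSuccs P Sum S →
    S ≡ σstep A B
  sup-of-sums {A} {B} supA supB supS with le⁺? B (ℓ⁺ A) in B≤ℓA
  sup-of-sums {fin a} {fin b} supA supB supS | lt = sup-B≤ℓA supA supB supS (inj₁ (cmp≡lt B≤ℓA))
  sup-of-sums {fin a} {fin b} supA supB supS | eq = sup-B≤ℓA supA supB supS (inj₂ (cmp≡eq B≤ℓA))
  sup-of-sums {ε₀} supA supB supS | lt = sup-A=ε₀ supA supS
  sup-of-sums {ε₀} supA supB supS | eq = sup-A=ε₀ supA supS
  sup-of-sums {fin a} {ε₀} supA supB supS | gt = sup-B=ε₀ supB supS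
  sup-of-sums {ε₀} {ε₀} supA supB supS | gt = sup-B=ε₀ supB supS
  sup-of-sums {fin a} {fin c} supA supB supS | gt with succView c in c-view
  ... | nothing = sup-B-limit supA supB supS (cmp≡gt B≤ℓA) c-view
  ... | just δ with cmp (ℓ a) δ in ℓa-vs-δ
  ...   | lt = sup-B-succ-above supA supB supS (succView-just c-view) (cmp≡lt ℓa-vs-δ)
  ...   | eq = sup-B-succ-at supA supB supS (succView-just c-view) (cmp≡eq ℓa-vs-δ)
  ...   | gt = contradiction (cmp≡gt ℓa-vs-δ)
                (≼⇒≯ (≺⊕one⇒≼ (subst (ℓ a ≺_) (succView-just {c} c-view) (cmp≡gt {c} B≤ℓA))))

module ◇-Countdown (α : Seq) = Countdown (λ i y → α i ⊕ ωp y) 𝟎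
module σ-Countdown (α : ℕ → Ord⁺) = Countdown (λ i y → σstep (α i) y) (fin one)

◇-countdown : ∀ n α i → ◇ n α i ≡ ◇-Countdown.countdown α n i
◇-countdown n α i with i ≤? n
... | yes _ = same-steps (n ∸ i) i
  where
  same-steps : ∀ k i → diamAux α k i ≡ ◇-Countdown.steps α k i
  same-steps zero    i = refl
  same-steps (suc k) i = cong (λ y → α i ⊕ ωp y) (same-steps k (suc i))
... | no  _ = refl

σ-countdown : ∀ n α i → σ n α i ≡ σ-Countdown.countdown α n i
σ-countdown n α i with i ≤? n
... | yes _ = same-steps (n ∸ i) i
  where
  same-steps : ∀ k i → σAux α k i ≡ σ-Countdown.steps α k i
  same-steps zero    i = refl
  same-steps (suc k) i = cong (σstep (α i)) (same-steps k (suc i))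
... | no  _ = refl

◇-above : ∀ n α {i} → ¬ (i ≤ℕ n) → ◇ n α i ≡ 𝟎
◇-above n α {i} i≰n = trans (◇-countdown n α i) (◇-Countdown.countdown-above α i≰n)

◇-unfold : ∀ n α {i} → i ≤ℕ n → ◇ n α i ≡ α i ⊕ ωp (◇ n α (suc i))
◇-unfold n α {i} i≤n = begin
  ◇ n α i                                         ≡⟨ ◇-countdown n α i ⟩
  ◇-Countdown.countdown α n i                     ≡⟨ ◇-Countdown.countdown-unfold α i≤n ⟩
  α i ⊕ ωp (◇-Countdown.countdown α n (suc i))
    ≡⟨ cong (λ y → α i ⊕ ωp y) (sym (◇-countdown n α (suc i))) ⟩
  α i ⊕ ωp (◇ n α (suc i))                        ∎
  where open ≡-Reasoning

◇-ind : ∀ n α (P : ℕ → Cnf → Set) → (∀ i → ¬ (i ≤ℕ n) → P i 𝟎) →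
  (∀ i {y} → i ≤ℕ n → P (suc i) y → P i (α i ⊕ ωp y)) → ∀ i → P i (◇ n α i)
◇-ind n α P P-above P-step i =
  subst (P i) (sym (◇-countdown n α i)) (◇-Countdown.countdown-ind α P P-above P-step i)

◇-nf : ∀ n α → (∀ j → NF (α j)) → ∀ j → NF (◇ n α j)
◇-nf n α nα = ◇-ind n α (λ _ → NF) (λ _ _ → nf𝟎) (λ i _ ny → NF-⊕ (nα i) (NF-ωp ny))

◇-mono : ∀ n α α′ → (∀ j → NF (α′ j)) → (∀ j → α j ≼ α′ j) → ∀ j → ◇ n α j ≼ ◇ n α′ j
◇-mono n α α′ nα′ α≼α′ = ◇-ind n α (λ i v → v ≼ ◇ n α′ i) (λ _ _ → 𝟎≼)
  (λ i i≤n y≼ → subst (_ ≼_) (sym (◇-unfold n α′ i≤n))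
                      (⊕-mono-≼ (NF-ωp (◇-nf n α′ nα′ (suc i))) (α≼α′ i) (ωp-mono-≼ y≼)))

◇-ign : ∀ n (γ : I) j → ◇ n (seq γ) (suc j) ≤ᶜ ℓ (◇ n (seq γ) j)
◇-ign n γ j =
  subst₂ (λ u v → u ≤ᶜ ℓ v) (sym (◇-countdown n (seq γ) (suc j))) (sym (◇-countdown n (seq γ) j))
  (countdown-ign (λ i y → seq γ i ⊕ ωp y) n (λ i y → inj₂ (sym (ℓ-⊕ωp (seq γ i) y))) j)

◇ᴵ : ℕ → I → I
◇ᴵ n γ = record { seq = ◇ n (seq γ) ; nf = ◇-nf n (seq γ) (nf γ) ; ign = ◇-ign n γ }

-- A supremum over the upward closure ◇ₙG equals the supremum over the
-- generators ◇ₙγ, γ ∈ G: every member lies above a generator.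
sup-◇Up : ∀ {G : I → Set} {n j o} → IsSupSucc (◇Up n G) j o →
  IsSupOfSuccs G (λ γ → ◇ n (seq γ) j) o
sup-◇Up {n = n} {j} (no-nf , upper , least) =
  no-nf , (λ γ γ∈G → upper (◇ᴵ n γ) (γ , γ∈G , λ i → ≼⇒≤ᶜ (≼-refl {◇ n (seq γ) i}))) ,
  (λ o′ no′ bound → least o′ no′ λ β (γ , γ∈G , ◇γ≤β) →
     ≤⁺-trans (fin-≼ (⊕-monoˡ-≼ one NF-one (≤ᶜ⇒≼ {seq β j} {◇ n (seq γ) j} (◇γ≤β j))))
              (bound γ γ∈G))

-- Above n every ◇ₙγ vanishes, so νᵢ = 0 + 1.
ν-above : ∀ (G : I → Set) → IsFilter G → ∀ n (ν : ℕ → Ord⁺) → IsAlphaF (◇Up n G) ν →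
  ∀ i → ¬ (i ≤ℕ n) → ν i ≡ fin one
ν-above G isF n ν hν i i≰n = SupFacts.sup-const G nf𝟎 (IsFilter.nonempty isF)
  (IsSupOfSuccs-cong (λ γ → ◇-above n (seq γ) i≰n) (sup-◇Up (hν i)))

-- At i ≤ n, (◇ₙγ)ᵢ = γᵢ + ω^((◇ₙγ)ᵢ₊₁), so νᵢ = σstep αᵢ νᵢ₊₁ by sup-of-sums.
ν-step : ∀ (G : I → Set) → IsFilter G → ∀ n (α ν : ℕ → Ord⁺) → IsAlphaF G α → IsAlphaF (◇Up n G) ν →
  ∀ i → i ≤ℕ n → ν i ≡ σstep (α i) (ν (suc i))
ν-step G isF n α ν hα hν i i≤n =
  S.sup-of-sums (hα i) (sup-◇Up (hν (suc i)))
    (IsSupOfSuccs-cong (λ γ → ◇-unfold n (seq γ) i≤n) (sup-◇Up (hν i)))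
  where
  directed : ∀ {γ γ′} → G γ → G γ′ → Σ I λ δ → G δ
    × seq γ i ≼ seq δ i × seq γ′ i ≼ seq δ i
    × ◇ n (seq γ) (suc i) ≼ ◇ n (seq δ) (suc i) × ◇ n (seq γ′) (suc i) ≼ ◇ n (seq δ) (suc i)
  directed {γ} {γ′} γ∈G γ′∈G with filter-directed isF γ∈G γ′∈G
  ... | δ , δ∈G , γ≼δ , γ′≼δ =
    δ , δ∈G , γ≼δ i , γ′≼δ i ,
    ◇-mono n (seq γ) (seq δ) (nf δ) γ≼δ (suc i) , ◇-mono n (seq γ′) (seq δ) (nf δ) γ′≼δ (suc i)
  module S = SupOfSums G (λ γ → seq γ i) (λ γ → ◇ n (seq γ) (suc i)) (IsFilter.nonempty isF)
                       directed (λ γ → nf γ i) (λ γ → ◇-nf n (seq γ) (nf γ) (suc i))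

mainTheorem8 : (G : I → Set) → IsFilter G → (n : ℕ) → (α ν : ℕ → Ord⁺)
    → IsAlphaF G α → IsAlphaF (◇Up n G) ν → ∀ i → ν i ≡ σ n α i
mainTheorem8 G isF n α ν hα hν i = begin
  ν i                           ≡⟨ ν-countdown i ⟩
  σ-Countdown.countdown α n i   ≡⟨ sym (σ-countdown n α i) ⟩
  σ n α i                       ∎
  where
  open ≡-Reasoning
  ν-countdown : ∀ i → ν i ≡ σ-Countdown.countdown α n i
  ν-countdown = σ-Countdown.countdown-ind α (λ i v → ν i ≡ v)
    (ν-above G isF n ν hν)
    (λ i i≤n ν₊≡ → trans (ν-step G isF n α ν hα hν i i≤n) (cong (σstep (α i)) ν₊≡))
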